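{- For all positive integers $n$ and $k$ with $k\geq 2$, and every function $\sigma\colon E(K_{4n})\to\{ -1,1\}$ with $|\sigma(E(K_{4n}))|<n(n-1)+k(6n-1)+k^2$, there is a perfect matching $M$ in $K_{4n}$ with $|\sigma(M)|\leq 2k-2$.
   Context: $K_{4n}$ denotes the complete graph on $4n$ vertices. For a set $F$ of edges, $\sigma(F)=\sum_{e\in F}\sigma(e)$. -}

module Defs where

open import Data.Nat using (ℕ; _<_; _<?_)
open import Data.Fin using (Fin; toℕ)
open import Data.Fin.Properties using (_≟_)
open import Data.Integer using (ℤ; +_; _+_)
open import Data.Sign using (Sign) renaming (+ to plus; - to minus)
open import Data.List using (List; []; _∷_; concatMap; allFin; length; filter; map; foldr)
open import Data.Product using (_×_; _,_)
open import Data.Sum using (_⊎_)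
open import Relation.Binary.PropositionalEquality using (_≡_)
open import Relation.Nullary using (Dec; yes; no)
open import Relation.Nullary.Decidable using (_⊎-dec_)

-- An edge of the complete graph K_m on vertex set Fin m: an unordered pair
-- {i , j} represented canonically by i , j with toℕ i < toℕ j.
record Edge (m : ℕ) : Set where
  constructor edge
  field
    u v : Fin m
    u<v : toℕ u < toℕ v
open Edge public

allEdges : (m : ℕ) → List (Edge m)
allEdges m = concatMap (λ i → concatMap (λ j → pick i j) (allFin m)) (allFin m)
  where
  pick : Fin m → Fin m → List (Edge m)
  pick i j with toℕ i <? toℕ j
  ... | yes p = edge i j p ∷ []
  ... | no _  = []

signℤ : Sign → ℤ
signℤ plus  = + 1
signℤ minus = Data.Integer.-[1+ 0 ]

σsum : {m : ℕ} → (Edge m → Sign) → List (Edge m) → ℤ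
σsum σ F = foldr (λ e acc → signℤ (σ e) + acc) (+ 0) F

Incident : {m : ℕ} → Fin m → Edge m → Set
Incident x e = (x ≡ u e) ⊎ (x ≡ v e)

incident? : {m : ℕ} → (x : Fin m) → (e : Edge m) → Dec (Incident x e)
incident? x e = (x ≟ u e) ⊎-dec (x ≟ v e)

degreeIn : {m : ℕ} → List (Edge m) → Fin m → ℕ
degreeIn M x = length (filter (incident? x) M)

-- M is a perfect matching of K_m: every vertex lies on exactly one edge of M
-- (in particular M has no repeated edges).
PerfectMatching : {m : ℕ} → List (Edge m) → Set
PerfectMatching {m} M = (x : Fin m) → degreeIn M x ≡ 1

-- Write n = k + t with t ≥ 0 (for k > n any perfect matching has only 2n ≤ 2k − 2 edges).
-- K_{4n} has 2n(4n − 1) edges, so |σ(E)| < n(n−1) + k(6n−1) + k² forces both the negative and the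
-- positive edges to number more than C(t,2) + t(4n − t), the Erdős–Gallai bound for 4n ≥ 3t + 2
-- vertices; hence each colour class contains a matching of t + 1 edges. List the vertices once
-- starting with the negative matching and once starting with the positive one, and pair up
-- consecutive vertices: this gives perfect matchings with at least t + 1 negative, resp. positive,
-- edges. Adjacent transpositions lead from one list to the other and change the number of negative
-- pairs by at most 2, so some list in between has between t + 1 and 2n − t − 1 negative pairs,
-- and its matching satisfies |σ(M)| ≤ 2n − 2(t + 1) = 2k − 2.
module Submission where

open import Defs
open import Data.Nat using (ℕ; _*_; _+_; _∸_; _^_; _≤_; _<_; suc)
open import Data.Integer using (∣_∣)
open import Data.Sign using (Sign)
open import Data.List using (List)
open import Data.Product using (Σ-syntax; _×_)

open import Data.Nat using (zero; z≤n; s≤s; _≤?_; _<?_; _⊔_)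
open import Data.Nat.Properties
open import Data.Nat.ListAction using (sum)
open import Data.Nat.ListAction.Properties using (sum-++; sum-↭)
open import Data.Nat.Tactic.RingSolver using (solve-∀)
open import Data.Integer as ℤ using (_⊖_)
open import Data.Integer.Properties
  using (distribʳ-⊖-+-pos; distribʳ-⊖-+-neg; ∣⊖∣-≤; ∣m⊖n∣≡∣n⊖m∣; ∣m⊝n∣≤m⊔n)
open import Data.Sign using () renaming (+ to plus; - to minus)
open import Data.Fin using (Fin; toℕ)
import Data.Fin.Properties as Fin
open import Data.Product using (_,_; ∃-syntax; proj₂)
open import Data.Sum as Sum using (_⊎_; inj₁; inj₂)
open import Data.Empty using (⊥-elim)
open import Data.List using ([]; _∷_; _++_; length; map; concatMap; allFin; filter)
open import Data.List.Properties
  using (map-++; map-cong; concatMap-cong; length-++; length-tabulate; filter-++; filter-accept; filter-reject)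
open import Data.List.Membership.Propositional using (_∈_; _∉_; find; lose)
open import Data.List.Membership.Propositional.Properties
  using (∈-∃++; ∈-allFin; ∈-++⁺ˡ; ∈-++⁺ʳ; ∈-filter⁺; ∈-filter⁻)
open import Data.List.Membership.Propositional.Properties.WithK using (unique∧set⇒bag)
open import Data.List.Relation.Binary.BagAndSetEquality using (∼bag⇒↭)
open import Data.List.Relation.Binary.Subset.Propositional using (_⊆_)
open import Data.List.Relation.Unary.Any using (here; there; any?)
open import Data.List.Relation.Unary.All as All using (All; []; _∷_)
open import Data.List.Relation.Unary.All.Properties using (¬Any⇒All¬; All¬⇒¬Any)
open import Data.List.Relation.Unary.AllPairs using ([]; _∷_)
import Data.List.Relation.Unary.AllPairs as AllPairs
open import Data.List.Relation.Unary.Unique.Propositional using (Unique)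
import Data.List.Relation.Unary.Unique.Propositional.Properties as UniqueP
open import Data.List.Relation.Binary.Permutation.Propositional
  using (_↭_; ↭-refl; ↭-prep; ↭-swap; ↭-sym; ↭-trans; ↭⇒↭ₛ)
import Data.List.Relation.Binary.Permutation.Propositional.Properties as Perm
import Data.List.Relation.Binary.Permutation.Setoid.Properties as PermSetoid
open import Function using (_∘_; id; _⇔_; mk⇔; Equivalence)
open import Relation.Nullary using (¬_; ¬?; yes; no)
open import Relation.Binary.Definitions using (DecidableEquality; tri<; tri≈; tri>)
open import Relation.Binary.Construct.Closure.ReflexiveTransitive using (Star; ε; _◅_; _◅◅_; gmap; fold)
open import Relation.Binary.PropositionalEquality

sumBy : {A : Set} → (A → ℕ) → List A → ℕ
sumBy g xs = sum (map g xs)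

module _ {A : Set} where

  sumBy-++ : (g : A → ℕ) (xs ys : List A) → sumBy g (xs ++ ys) ≡ sumBy g xs + sumBy g ys
  sumBy-++ g xs ys = trans (cong sum (map-++ g xs ys)) (sum-++ (map g xs) (map g ys))

  sumBy-↭ : (g : A → ℕ) {xs ys : List A} → xs ↭ ys → sumBy g xs ≡ sumBy g ys
  sumBy-↭ g p = sum-↭ (Perm.map⁺ g p)

  sumBy-cong : {g h : A → ℕ} → (∀ x → g x ≡ h x) → (xs : List A) → sumBy g xs ≡ sumBy h xs
  sumBy-cong g≗h xs = cong sum (map-cong g≗h xs)

  sumBy-+ : (g h : A → ℕ) (xs : List A) → sumBy (λ x → g x + h x) xs ≡ sumBy g xs + sumBy h xs
  sumBy-+ g h [] = refl
  sumBy-+ g h (x ∷ xs) = trans (cong (g x + h x +_) (sumBy-+ g h xs)) (+-+-comm (g x) (h x) _ _)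
    where
    +-+-comm : ∀ a b c d → a + b + (c + d) ≡ a + c + (b + d)
    +-+-comm = solve-∀

  sumBy-const : (c : ℕ) (xs : List A) → sumBy (λ _ → c) xs ≡ length xs * c
  sumBy-const c [] = refl
  sumBy-const c (x ∷ xs) = cong (c +_) (sumBy-const c xs)

  sumBy-1 : (xs : List A) → sumBy (λ _ → 1) xs ≡ length xs
  sumBy-1 xs = trans (sumBy-const 1 xs) (*-identityʳ (length xs))

  sumBy-≡1 : (g : A → ℕ) {xs : List A} → All (λ x → g x ≡ 1) xs → sumBy g xs ≡ length xs
  sumBy-≡1 g [] = refl
  sumBy-≡1 g (gx≡1 ∷ gxs≡1) = cong₂ _+_ gx≡1 (sumBy-≡1 g gxs≡1)

  sumBy-≤-length : (g : A → ℕ) → (∀ x → g x ≤ 1) → (xs : List A) → sumBy g xs ≤ length xs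
  sumBy-≤-length g g≤1 [] = z≤n
  sumBy-≤-length g g≤1 (x ∷ xs) = +-mono-≤ (g≤1 x) (sumBy-≤-length g g≤1 xs)

  length-≤-sumBy : (g : A → ℕ) {xs : List A} → All (λ x → 0 < g x) xs → length xs ≤ sumBy g xs
  length-≤-sumBy g [] = z≤n
  length-≤-sumBy g (gx>0 ∷ gxs>0) = +-mono-≤ gx>0 (length-≤-sumBy g gxs>0)

  sumBy>0⇒∃ : (g : A → ℕ) (xs : List A) → 0 < sumBy g xs → ∃[ x ] (x ∈ xs × 0 < g x)
  sumBy>0⇒∃ g (x ∷ xs) sum>0 with g x in gx≡
  ... | suc _ = x , here refl , subst (0 <_) (sym gx≡) (s≤s z≤n)
  ... | zero with y , y∈xs , gy>0 ← sumBy>0⇒∃ g xs sum>0 = y , there y∈xs , gy>0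

module _ {A B : Set} where

  sumBy-swap : (h : A → B → ℕ) (xs : List A) (ys : List B) →
    sumBy (λ x → sumBy (h x) ys) xs ≡ sumBy (λ y → sumBy (λ x → h x y) xs) ys
  sumBy-swap h [] ys = sym (trans (sumBy-const 0 ys) (*-zeroʳ (length ys)))
  sumBy-swap h (x ∷ xs) ys = trans (cong (sumBy (h x) ys +_) (sumBy-swap h xs ys))
    (sym (sumBy-+ (h x) (λ y → sumBy (λ x′ → h x′ y) xs) ys))

  sumBy-concatMap : (g : B → ℕ) (f : A → List B) (xs : List A) →
    sumBy g (concatMap f xs) ≡ sumBy (λ x → sumBy g (f x)) xs
  sumBy-concatMap g f [] = refl
  sumBy-concatMap g f (x ∷ xs) =
    trans (sumBy-++ g (f x) (concatMap f xs)) (cong (sumBy g (f x) +_) (sumBy-concatMap g f xs))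

module _ {A : Set} where

  Unique-resp-↭ : {xs ys : List A} → xs ↭ ys → Unique xs → Unique ys
  Unique-resp-↭ p = PermSetoid.AllPairs-resp-↭ (setoid A) (λ x≢y y≡x → x≢y (sym y≡x))
    ((λ { refl r → r }) , (λ { refl r → r })) (↭⇒↭ₛ p)

  ∈-↭∷⁻ : {x z : A} {xs ys : List A} → xs ↭ x ∷ ys → z ∈ xs → z ≢ x → z ∈ ys
  ∈-↭∷⁻ xs↭ z∈xs z≢x with Perm.∈-resp-↭ xs↭ z∈xs
  ... | here z≡x = ⊥-elim (z≢x z≡x)
  ... | there z∈ys = z∈ys

  ∈-↭∷⁺ : {x z : A} {xs ys : List A} → xs ↭ x ∷ ys → z ∈ x ∷ ys → z ∈ xs
  ∈-↭∷⁺ xs↭ = Perm.∈-resp-↭ (↭-sym xs↭)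

  ∈⇒↭∷ : {x : A} {xs : List A} → x ∈ xs → ∃[ ys ] (xs ↭ x ∷ ys)
  ∈⇒↭∷ {x} x∈xs with as , bs , refl ← ∈-∃++ x∈xs = as ++ bs , Perm.shift x as bs

module _ {A : Set} (_≟_ : DecidableEquality A) where
  open import Data.List.Membership.DecPropositional _≟_ using (_∈?_)

  pigeonhole : (g : A → ℕ) → (∀ x → g x ≤ 1) → {V : List A} → Unique V → (W : List A) →
    length W < sumBy g V → ∃[ y ] (y ∈ V × 0 < g y × y ∉ W)
  pigeonhole g g≤1 {y ∷ V} (y∉V ∷ uV) W W<sum with 0 <? g y | y ∈? W
  ... | no gy≯0 | _
    with z , z∈V , gz>0 , z∉W ← pigeonhole g g≤1 uV W
           (subst (λ c → length W < c + sumBy g V) (n≤0⇒n≡0 (≮⇒≥ gy≯0)) W<sum)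
    = z , there z∈V , gz>0 , z∉W
  ... | yes gy>0 | no y∉W = y , here refl , gy>0 , y∉W
  ... | yes gy>0 | yes y∈W
    with W′ , W↭ ← ∈⇒↭∷ y∈W
    with z , z∈V , gz>0 , z∉W′ ← pigeonhole g g≤1 uV W′
           (+-cancelˡ-< 1 _ _ (<-≤-trans (subst (_< sumBy g (y ∷ V)) (Perm.↭-length W↭) W<sum)
                                         (+-monoˡ-≤ (sumBy g V) (g≤1 y))))
    = z , there z∈V , gz>0 , z∉W
    where
    z∉W : z ∉ W
    z∉W z∈W with Perm.∈-resp-↭ W↭ z∈W
    ... | here refl = All¬⇒¬Any y∉V z∈V
    ... | there z∈W′ = z∉W′ z∈W′

-- Pairing up consecutive elements

unpair : {A : Set} → List (A × A) → List A
unpair [] = []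
unpair ((x , y) ∷ ps) = x ∷ y ∷ unpair ps

length-unpair : {A : Set} (ps : List (A × A)) → length (unpair ps) ≡ 2 * length ps
length-unpair [] = refl
length-unpair ((x , y) ∷ ps) = cong suc (trans (cong suc (length-unpair ps)) (sym (+-suc (length ps) _)))

pairUp : {A : Set} → List A → List (A × A)
pairUp (x ∷ y ∷ xs) = (x , y) ∷ pairUp xs
pairUp _ = []

module _ {A : Set} where

  pairUp-unpair-++ : (ps : List (A × A)) (xs : List A) → pairUp (unpair ps ++ xs) ≡ ps ++ pairUp xs
  pairUp-unpair-++ [] xs = refl
  pairUp-unpair-++ ((x , y) ∷ ps) xs = cong ((x , y) ∷_) (pairUp-unpair-++ ps xs)

  unpair-pairUp : ∀ h (xs : List A) → length xs ≡ h + h → unpair (pairUp xs) ≡ xs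
  unpair-pairUp h [] _ = refl
  unpair-pairUp (suc h) (x ∷ y ∷ xs) |xs| =
    cong (λ zs → x ∷ y ∷ zs) (unpair-pairUp h xs (suc-injective (trans (suc-injective |xs|) (+-suc h h))))
  unpair-pairUp zero (x ∷ xs) ()
  unpair-pairUp (suc h) (x ∷ []) |xs| with () ← trans (suc-injective |xs|) (+-suc h h)

  length-pairUp : ∀ h (xs : List A) → length xs ≡ h + h → length (pairUp xs) ≡ h
  length-pairUp h xs |xs| = *-cancelˡ-≡ _ h 2 (begin
    2 * length (pairUp xs)         ≡⟨ length-unpair (pairUp xs) ⟨
    length (unpair (pairUp xs))    ≡⟨ cong length (unpair-pairUp h xs |xs|) ⟩
    length xs                      ≡⟨ |xs| ⟩
    h + h                          ≡⟨ cong (h +_) (+-identityʳ h) ⟨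
    2 * h                          ∎)
    where open ≡-Reasoning

  Unique-unpair⇒≢ : (ps : List (A × A)) → Unique (unpair ps) → All (λ (x , y) → x ≢ y) ps
  Unique-unpair⇒≢ [] _ = []
  Unique-unpair⇒≢ ((x , y) ∷ ps) ((x≢y ∷ _) ∷ (_ ∷ u)) = x≢y ∷ Unique-unpair⇒≢ ps u

  pairSum : (A → A → ℕ) → List A → ℕ
  pairSum g xs = sumBy (λ (x , y) → g x y) (pairUp xs)

  data AdjacentSwap : List A → List A → Set where
    here  : ∀ x y xs → AdjacentSwap (x ∷ y ∷ xs) (y ∷ x ∷ xs)
    there : ∀ z {xs ys} → AdjacentSwap xs ys → AdjacentSwap (z ∷ xs) (z ∷ ys)

  AdjacentSwaps : List A → List A → Set
  AdjacentSwaps = Star AdjacentSwap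

  ↭⇒AdjacentSwaps : ∀ {xs ys} → xs ↭ ys → AdjacentSwaps xs ys
  ↭⇒AdjacentSwaps _↭_.refl = ε
  ↭⇒AdjacentSwaps (_↭_.prep x p) = gmap (x ∷_) (there x) (↭⇒AdjacentSwaps p)
  ↭⇒AdjacentSwaps (_↭_.swap x y p) =
    here x y _ ◅ gmap (y ∷_) (there y) (gmap (x ∷_) (there x) (↭⇒AdjacentSwaps p))
  ↭⇒AdjacentSwaps (_↭_.trans p q) = ↭⇒AdjacentSwaps p ◅◅ ↭⇒AdjacentSwaps q

  AdjacentSwaps⇒↭ : ∀ {xs ys} → AdjacentSwaps xs ys → xs ↭ ys
  AdjacentSwaps⇒↭ = fold _↭_ (λ s p → ↭-trans (swap⇒↭ s) p) ↭-refl
    where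
    swap⇒↭ : ∀ {xs ys} → AdjacentSwap xs ys → xs ↭ ys
    swap⇒↭ (here x y xs) = ↭-swap x y ↭-refl
    swap⇒↭ (there z s) = ↭-prep z (swap⇒↭ s)

  -- An adjacent swap changes at most two of the consecutive pairs; the mutual recursion
  -- tracks whether the swap falls inside a pair or between two pairs.
  module _ (g : A → A → ℕ) (g-sym : ∀ x y → g x y ≡ g y x) (g≤1 : ∀ x y → g x y ≤ 1) where

    pairSum-swap : ∀ {xs ys} → AdjacentSwap xs ys → pairSum g xs ≤ pairSum g ys + 2
    pairSum-swap-shifted : ∀ {xs ys} → AdjacentSwap xs ys →
      ∀ w → pairSum g (w ∷ xs) ≤ pairSum g (w ∷ ys) + 2

    pairSum-swap (here x y xs) = ≤-trans (≤-reflexive (cong (_+ pairSum g xs) (g-sym x y))) (m≤m+n _ 2)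
    pairSum-swap (there z s) = pairSum-swap-shifted s z

    pairSum-swap-shifted (here x y []) w = ≤-trans (+-monoˡ-≤ 0 (≤-trans (g≤1 w x) (s≤s z≤n))) (m≤n+m 2 _)
    pairSum-swap-shifted (here x y (z ∷ xs)) w = begin
      g w x + (g y z + R)   ≡⟨ +-assoc (g w x) (g y z) R ⟨
      g w x + g y z + R     ≤⟨ +-monoˡ-≤ R (+-mono-≤ (g≤1 w x) (g≤1 y z)) ⟩
      2 + R                 ≤⟨ +-monoʳ-≤ 2 (m≤n+m R (g w y + g x z)) ⟩
      2 + (g w y + g x z + R) ≡⟨ +-comm 2 _ ⟩
      g w y + g x z + R + 2 ≡⟨ cong (_+ 2) (+-assoc (g w y) (g x z) R) ⟩
      g w y + (g x z + R) + 2 ∎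
      where
      open ≤-Reasoning
      R : ℕ
      R = pairSum g xs
    pairSum-swap-shifted (there z {xs} {ys} s) w =
      ≤-trans (+-monoʳ-≤ (g w z) (pairSum-swap s)) (≤-reflexive (sym (+-assoc (g w z) (pairSum g ys) 2)))

module _ {A : Set} {R : A → A → Set} (f : A → ℕ) (d : ℕ) (step : ∀ {x y} → R x y → f x ≤ f y + d) where

  intermediate-value : ∀ {x z} lo hi → lo + d ≤ suc hi → Star R x z → lo ≤ f x → f z ≤ hi →
    ∃[ y ] (Star R x y × lo ≤ f y × f y ≤ hi)
  intermediate-value {x} lo hi _ ε lo≤fx fz≤hi = x , ε , lo≤fx , fz≤hi
  intermediate-value {x} lo hi window (_◅_ {j = y} r path) lo≤fx fz≤hi with f x ≤? hi
  ... | yes fx≤hi = x , ε , lo≤fx , fx≤hi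
  ... | no fx≰hi = prepend (intermediate-value lo hi window path lo≤next fz≤hi)
    where
    prepend : ∃[ w ] (Star R y w × lo ≤ f w × f w ≤ hi) → ∃[ w ] (Star R x w × lo ≤ f w × f w ≤ hi)
    prepend (w , path′ , lo≤fw , fw≤hi) = w , r ◅ path′ , lo≤fw , fw≤hi
    lo≤next : lo ≤ f y
    lo≤next = +-cancelʳ-≤ d lo _ (≤-trans window (≤-trans (≰⇒> fx≰hi) (step r)))

-- Large matchings

+-cancel-<-≤ : ∀ a b c d → a + c < b + d → b ≤ c → a < d
+-cancel-<-≤ a b c d a+c<b+d b≤c =
  +-cancelʳ-< c a d (<-≤-trans a+c<b+d (≤-trans (+-monoˡ-≤ d b≤c) (≤-reflexive (+-comm c d))))

-- For ℓ = 3t + 2 + e vertices this is 2 (C(t,2) + t (ℓ − t)), twice the Erdős–Gallai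
-- extremal number of edges in a graph with no matching of t + 1 edges.
matchingThreshold : ℕ → ℕ → ℕ
matchingThreshold t e = 5 * t * t + 3 * t + 2 * t * e

matchingThreshold-suc-high : ∀ t e →
  matchingThreshold (suc t) e ≡ matchingThreshold t (e + 2) + 2 * (3 * t + 2 + (e + 2))
matchingThreshold-suc-high = identity
  where
  identity : ∀ t e → 5 * (1 + t) * (1 + t) + 3 * (1 + t) + 2 * (1 + t) * e ≡
    5 * t * t + 3 * t + 2 * t * (e + 2) + 2 * (3 * t + 2 + (e + 2))
  identity = solve-∀

matchingThreshold-suc-low : ∀ t e →
  matchingThreshold (suc t) e ≡ matchingThreshold t (suc e) + (2 * (2 * suc t) + 2 * (2 * suc t) + 2 * e)
matchingThreshold-suc-low = identity
  where
  identity : ∀ t e → 5 * (1 + t) * (1 + t) + 3 * (1 + t) + 2 * (1 + t) * e ≡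
    5 * t * t + 3 * t + 2 * t * (1 + e) + (2 * (2 * (1 + t)) + 2 * (2 * (1 + t)) + 2 * e)
  identity = solve-∀

module SimpleGraph {m : ℕ} (adj : Fin m → Fin m → ℕ)
  (adj-sym : ∀ x y → adj x y ≡ adj y x) (adj-irrefl : ∀ x → adj x x ≡ 0)
  (adj≤1 : ∀ x y → adj x y ≤ 1) where

  degree : List (Fin m) → Fin m → ℕ
  degree V x = sumBy (adj x) V

  degreeSum : List (Fin m) → ℕ
  degreeSum V = sumBy (degree V) V

  adj⇒≢ : ∀ {x y} → 0 < adj x y → x ≢ y
  adj⇒≢ {x} x~y refl = <-irrefl (sym (adj-irrefl x)) x~y

  degree≤length : ∀ V x → degree V x ≤ length V
  degree≤length V x = sumBy-≤-length (adj x) (adj≤1 x) V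

  degree-↭ : ∀ {V V′} → V ↭ V′ → ∀ x → degree V x ≡ degree V′ x
  degree-↭ V↭V′ x = sumBy-↭ (adj x) V↭V′

  degree-↭∷-≤ : ∀ {V V′ v} → V ↭ v ∷ V′ → ∀ x → degree V′ x ≤ degree V x
  degree-↭∷-≤ {v = v} V↭ x = ≤-trans (m≤n+m _ (adj x v)) (≤-reflexive (sym (degree-↭ V↭ x)))

  degree-↭∷-self : ∀ {V V′ v} → V ↭ v ∷ V′ → degree V v ≡ degree V′ v
  degree-↭∷-self {V′ = V′} {v} V↭ = trans (degree-↭ V↭ v) (cong (_+ degree V′ v) (adj-irrefl v))

  degreeSum-∷ : ∀ v V → degreeSum (v ∷ V) ≡ 2 * degree V v + degreeSum V
  degreeSum-∷ v V = begin
    adj v v + degree V v + sumBy (λ x → adj x v + degree V x) V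
      ≡⟨ cong₂ _+_ (cong (_+ degree V v) (adj-irrefl v))
                   (trans (sumBy-cong (λ x → cong (_+ degree V x) (adj-sym x v)) V)
                          (sumBy-+ (adj v) (degree V) V)) ⟩
    degree V v + (degree V v + degreeSum V)
      ≡⟨ +-assoc-double (degree V v) (degreeSum V) ⟩
    2 * degree V v + degreeSum V ∎
    where
    open ≡-Reasoning
    +-assoc-double : ∀ d D → d + (d + D) ≡ 2 * d + D
    +-assoc-double = solve-∀

  degreeSum-↭∷ : ∀ {V V′ v} → V ↭ v ∷ V′ → degreeSum V ≡ 2 * degree V′ v + degreeSum V′
  degreeSum-↭∷ {V} {V′} {v} V↭ =
    trans (sumBy-↭ (degree V) V↭) (trans (sumBy-cong (degree-↭ V↭) (v ∷ V′)) (degreeSum-∷ v V′))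

  edge-of-degreeSum>0 : ∀ V → 0 < degreeSum V → ∃[ x ] ∃[ y ] (x ∈ V × y ∈ V × 0 < adj x y)
  edge-of-degreeSum>0 V D>0 with x , x∈V , deg>0 ← sumBy>0⇒∃ (degree V) V D>0
                            with y , y∈V , x~y ← sumBy>0⇒∃ (adj x) V deg>0
                            = x , y , x∈V , y∈V , x~y

  record Matching (V : List (Fin m)) (s : ℕ) : Set where
    field
      pairs    : List (Fin m × Fin m)
      size     : length pairs ≡ s
      unique   : Unique (unpair pairs)
      ⊆V       : unpair pairs ⊆ V
      adjacent : All (λ (x , y) → 0 < adj x y) pairs

  extend : ∀ {V V′ s x y} (M : Matching V′ s) → V′ ⊆ V → x ∈ V → y ∈ V → 0 < adj x y →
    x ∉ unpair (Matching.pairs M) → y ∉ unpair (Matching.pairs M) → Matching V (suc s)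
  extend {x = x} {y} M V′⊆V x∈V y∈V x~y x∉M y∉M = record
    { pairs    = (x , y) ∷ pairs
    ; size     = cong suc size
    ; unique   = (adj⇒≢ x~y ∷ ¬Any⇒All¬ _ x∉M) ∷ (¬Any⇒All¬ _ y∉M ∷ unique)
    ; ⊆V       = λ { (here refl) → x∈V
                   ; (there (here refl)) → y∈V
                   ; (there (there z∈M)) → V′⊆V (⊆V z∈M) }
    ; adjacent = x~y ∷ adjacent
    }
    where open Matching M

  empty : ∀ {V} → Matching V 0
  empty = record { pairs = [] ; size = refl ; unique = [] ; ⊆V = λ () ; adjacent = [] }

  ErdősGallai : ℕ → Set
  ErdősGallai t = ∀ e V → Unique V → length V ≡ 3 * t + 2 + e →
    matchingThreshold t e < degreeSum V → Matching V (suc t)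

  erdősGallai-zero : ErdősGallai 0
  erdősGallai-zero e V _ _ D>0 with x , y , x∈V , y∈V , x~y ← edge-of-degreeSum>0 V D>0 =
    extend {V′ = []} empty (λ ()) x∈V y∈V x~y (λ ()) (λ ())

  -- A vertex v of degree above 2(t + 1) can be matched to a neighbour missed by any
  -- matching of t + 1 edges in the rest of the graph.
  erdősGallai-high : ∀ {t} → ErdősGallai t → ∀ e {V V′ v} → V ↭ v ∷ V′ → Unique V →
    length V ≡ 3 * suc t + 2 + e → matchingThreshold (suc t) e < degreeSum V →
    2 * suc t < degree V v → Matching V (suc (suc t))
  erdősGallai-high {t} rec e {V} {V′} {v} V↭ uV |V| D> deg> =
    addNeighbour (pigeonhole Fin._≟_ (adj v) (adj≤1 v) uV′ (unpair pairs) |M|<deg)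
    where
    uvV′ : Unique (v ∷ V′)
    uvV′ = Unique-resp-↭ V↭ uV
    uV′ : Unique V′
    uV′ = AllPairs.tail uvV′
    V′⊆V : V′ ⊆ V
    V′⊆V = λ z∈V′ → ∈-↭∷⁺ V↭ (there z∈V′)
    |V′| : length V′ ≡ 3 * t + 2 + (e + 2)
    |V′| = suc-injective (trans (sym (Perm.↭-length V↭)) (trans |V| (length-identity t e)))
      where
      length-identity : ∀ t e → 3 * (1 + t) + 2 + e ≡ 1 + (3 * t + 2 + (e + 2))
      length-identity = solve-∀
    d : ℕ
    d = degree V′ v
    D′> : matchingThreshold t (e + 2) < degreeSum V′
    D′> = +-cancel-<-≤ _ (2 * d) _ _
      (subst₂ _<_ (matchingThreshold-suc-high t e) (degreeSum-↭∷ V↭) D>)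
      (*-monoʳ-≤ 2 (subst (d ≤_) |V′| (degree≤length V′ v)))
    M : Matching V′ (suc t)
    M = rec (e + 2) V′ uV′ |V′| D′>
    open Matching M
    |M|<deg : length (unpair pairs) < degree V′ v
    |M|<deg = subst₂ _<_ (sym (trans (length-unpair pairs) (cong (2 *_) size))) (degree-↭∷-self V↭) deg>
    addNeighbour : ∃[ y ] (y ∈ V′ × 0 < adj v y × y ∉ unpair pairs) → Matching V (suc (suc t))
    addNeighbour (y , y∈V′ , v~y , y∉M) =
      extend M V′⊆V (∈-↭∷⁺ V↭ (here refl)) (V′⊆V y∈V′) v~y
        (All¬⇒¬Any (AllPairs.head uvV′) ∘ ⊆V) y∉M

  -- With all degrees at most 2(t + 1), deleting both ends of an edge lowers the degree sum
  -- by at most 8(t + 1), which the drop of the threshold absorbs.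
  erdősGallai-low : ∀ {t} → ErdősGallai t → ∀ e {V V₁ V₂ x y} →
    V ↭ x ∷ V₁ → V₁ ↭ y ∷ V₂ → Unique V → length V ≡ 3 * suc t + 2 + e → matchingThreshold (suc t) e < degreeSum V →
    0 < adj x y → degree V x ≤ 2 * suc t → degree V y ≤ 2 * suc t → Matching V (suc (suc t))
  erdősGallai-low {t} rec e {V} {V₁} {V₂} {x} {y} V↭ V₁↭ uV |V| D> x~y degx≤ degy≤ =
    extend M V₂⊆V (∈-↭∷⁺ V↭ (here refl)) (V₁⊆V (∈-↭∷⁺ V₁↭ (here refl))) x~y
      (All¬⇒¬Any (AllPairs.head uxV₁) ∘ V₂⊆V₁ ∘ ⊆V) (All¬⇒¬Any (AllPairs.head uyV₂) ∘ ⊆V)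
    where
    uxV₁ : Unique (x ∷ V₁)
    uxV₁ = Unique-resp-↭ V↭ uV
    uyV₂ : Unique (y ∷ V₂)
    uyV₂ = Unique-resp-↭ V₁↭ (AllPairs.tail uxV₁)
    V₁⊆V : V₁ ⊆ V
    V₁⊆V = λ z∈V₁ → ∈-↭∷⁺ V↭ (there z∈V₁)
    V₂⊆V₁ : V₂ ⊆ V₁
    V₂⊆V₁ = λ z∈V₂ → ∈-↭∷⁺ V₁↭ (there z∈V₂)
    V₂⊆V : V₂ ⊆ V
    V₂⊆V = V₁⊆V ∘ V₂⊆V₁
    |V₂| : length V₂ ≡ 3 * t + 2 + suc e
    |V₂| = suc-injective (suc-injective (trans (cong suc (sym (Perm.↭-length V₁↭)))
             (trans (sym (Perm.↭-length V↭)) (trans |V| (length-identity t e)))))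
      where
      length-identity : ∀ t e → 3 * (1 + t) + 2 + e ≡ 2 + (3 * t + 2 + (1 + e))
      length-identity = solve-∀
    d₁ d₂ : ℕ
    d₁ = degree V₁ x
    d₂ = degree V₂ y
    D₂> : matchingThreshold t (suc e) < degreeSum V₂
    D₂> = +-cancel-<-≤ _ (2 * d₁ + 2 * d₂) _ _
      (subst₂ _<_ (matchingThreshold-suc-low t e)
        (trans (degreeSum-↭∷ V↭)
          (trans (cong (2 * d₁ +_) (degreeSum-↭∷ V₁↭)) (sym (+-assoc (2 * d₁) _ _)))) D>)
      (≤-trans (+-mono-≤ (*-monoʳ-≤ 2 (≤-trans (degree-↭∷-≤ V↭ x) degx≤))
                         (*-monoʳ-≤ 2 (≤-trans (degree-↭∷-≤ V₁↭ y)
                                         (≤-trans (degree-↭∷-≤ V↭ y) degy≤))))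
               (m≤m+n _ (2 * e)))
    M : Matching V₂ (suc t)
    M = rec (suc e) V₂ (AllPairs.tail uyV₂) |V₂| D₂>
    open Matching M

  erdősGallai : ∀ t → ErdősGallai t
  erdősGallai zero = erdősGallai-zero
  erdősGallai (suc t) e V uV |V| D> with any? (λ v → 2 * suc t <? degree V v) V
  ... | yes high with v , v∈V , deg> ← find high with V′ , V↭ ← ∈⇒↭∷ v∈V =
    erdősGallai-high (erdősGallai t) e V↭ uV |V| D> deg>
  ... | no ¬high
    with x , y , x∈V , y∈V , x~y ← edge-of-degreeSum>0 V (≤-trans (s≤s z≤n) D>)
    with V₁ , V↭ ← ∈⇒↭∷ x∈V
    with V₂ , V₁↭ ← ∈⇒↭∷ (∈-↭∷⁻ V↭ y∈V (adj⇒≢ x~y ∘ sym)) =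
    erdősGallai-low (erdősGallai t) e V↭ V₁↭ uV |V| D> x~y (low x∈V) (low y∈V)
    where
    low : ∀ {v} → v ∈ V → degree V v ≤ 2 * suc t
    low v∈V = ≮⇒≥ (¬high ∘ lose v∈V)

-- The complete graph K_m

module _ {m : ℕ} where

  orderedEdge : Fin m → Fin m → List (Edge m)
  orderedEdge i j with toℕ i <? toℕ j
  ... | yes i<j = edge i j i<j ∷ []
  ... | no _ = []

  edgeBetween : Fin m → Fin m → List (Edge m)
  edgeBetween i j = orderedEdge i j ++ orderedEdge j i

  -- Defs builds allEdges from a local helper that cannot be named here; unification
  -- against the unfolded definition recovers it.
  private
    helperOf : {pick : Fin m → Fin m → List (Edge m)} →
      allEdges m ≡ concatMap (λ i → concatMap (pick i) (allFin m)) (allFin m) →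
      Fin m → Fin m → List (Edge m)
    helperOf {pick} _ = pick

    helper-≡ : ∀ i j → helperOf refl i j ≡ orderedEdge i j
    helper-≡ i j with toℕ i <? toℕ j
    ... | yes _ = refl
    ... | no _ = refl

  allEdges-≡ : allEdges m ≡ concatMap (λ i → concatMap (orderedEdge i) (allFin m)) (allFin m)
  allEdges-≡ = concatMap-cong (λ i → concatMap-cong (helper-≡ i) (allFin m)) (allFin m)

  orderedEdge-< : ∀ {i j} (i<j : toℕ i < toℕ j) → orderedEdge i j ≡ edge i j i<j ∷ []
  orderedEdge-< {i} {j} i<j with toℕ i <? toℕ j
  ... | yes i<j′ = cong (λ p → edge i j p ∷ []) (<-irrelevant i<j′ i<j)
  ... | no i≮j = ⊥-elim (i≮j i<j)

  orderedEdge-≮ : ∀ {i j} → ¬ toℕ i < toℕ j → orderedEdge i j ≡ []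
  orderedEdge-≮ {i} {j} i≮j with toℕ i <? toℕ j
  ... | yes i<j = ⊥-elim (i≮j i<j)
  ... | no _ = refl

  edgeBetween-self : ∀ i → edgeBetween i i ≡ []
  edgeBetween-self i = cong₂ _++_ i≮i i≮i
    where
    i≮i : orderedEdge i i ≡ []
    i≮i = orderedEdge-≮ {i} {i} (<-irrefl refl)

  edgeBetween-≢ : ∀ {i j} → i ≢ j →
    ∃[ e ] (edgeBetween i j ≡ e ∷ [] × (∀ x → Incident x e ⇔ (x ≡ i ⊎ x ≡ j)))
  edgeBetween-≢ {i} {j} i≢j with <-cmp (toℕ i) (toℕ j)
  ... | tri< i<j _ j≮i =
    edge i j i<j , cong₂ _++_ (orderedEdge-< i<j) (orderedEdge-≮ j≮i) , λ _ → mk⇔ id id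
  ... | tri≈ _ i≡j _ = ⊥-elim (i≢j (Fin.toℕ-injective i≡j))
  ... | tri> i≮j _ j<i =
    edge j i j<i , cong₂ _++_ (orderedEdge-≮ i≮j) (orderedEdge-< j<i) , λ _ → mk⇔ Sum.swap Sum.swap

  length-edgeBetween-≢ : ∀ {i j} → i ≢ j → length (edgeBetween i j) ≡ 1
  length-edgeBetween-≢ i≢j with e , ≡[e] , _ ← edgeBetween-≢ i≢j = cong length ≡[e]

  sumBy-edgeBetween-sym : (h : Edge m → ℕ) → ∀ i j → sumBy h (edgeBetween i j) ≡ sumBy h (edgeBetween j i)
  sumBy-edgeBetween-sym h i j = sumBy-↭ h (Perm.++-comm (orderedEdge i j) (orderedEdge j i))

  sumBy-edgeBetween-≤1 : (h : Edge m → ℕ) → (∀ e → h e ≤ 1) → ∀ i j → sumBy h (edgeBetween i j) ≤ 1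
  sumBy-edgeBetween-≤1 h h≤1 i j with i Fin.≟ j
  ... | yes refl = ≤-trans (≤-reflexive (cong (sumBy h) (edgeBetween-self i))) z≤n
  ... | no i≢j = ≤-trans (sumBy-≤-length h h≤1 (edgeBetween i j)) (≤-reflexive (length-edgeBetween-≢ i≢j))

  degreeIn-++ : ∀ (xs ys : List (Edge m)) x → degreeIn (xs ++ ys) x ≡ degreeIn xs x + degreeIn ys x
  degreeIn-++ xs ys x = trans (cong length (filter-++ (incident? x) xs ys)) (length-++ (filter (incident? x) xs))

  degreeIn-edgeBetween-end : ∀ {i j x} → i ≢ j → x ≡ i ⊎ x ≡ j → degreeIn (edgeBetween i j) x ≡ 1
  degreeIn-edgeBetween-end {x = x} i≢j x∈ij with e , ≡[e] , ends ← edgeBetween-≢ i≢j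
    rewrite ≡[e] = cong length (filter-accept (incident? x) (Equivalence.from (ends x) x∈ij))

  degreeIn-edgeBetween-other : ∀ {i j x} → x ≢ i → x ≢ j → degreeIn (edgeBetween i j) x ≡ 0
  degreeIn-edgeBetween-other {i} {j} {x} x≢i x≢j with i Fin.≟ j
  ... | yes refl = cong (λ es → degreeIn es x) (edgeBetween-self i)
  ... | no i≢j with e , ≡[e] , ends ← edgeBetween-≢ i≢j rewrite ≡[e] =
    cong length (filter-reject (incident? x) (Sum.[ x≢i , x≢j ] ∘ Equivalence.to (ends x)))

  matchingOf : List (Fin m × Fin m) → List (Edge m)
  matchingOf = concatMap (λ (i , j) → edgeBetween i j)

  degreeIn-matchingOf-∉ : ∀ ps {x} → x ∉ unpair ps → degreeIn (matchingOf ps) x ≡ 0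
  degreeIn-matchingOf-∉ [] _ = refl
  degreeIn-matchingOf-∉ ((i , j) ∷ ps) {x} x∉ = begin
    degreeIn (edgeBetween i j ++ matchingOf ps) x          ≡⟨ degreeIn-++ (edgeBetween i j) _ x ⟩
    degreeIn (edgeBetween i j) x + degreeIn (matchingOf ps) x
      ≡⟨ cong₂ _+_ (degreeIn-edgeBetween-other {i} {j} (λ x≡i → x∉ (here x≡i))
                                                       (λ x≡j → x∉ (there (here x≡j))))
                   (degreeIn-matchingOf-∉ ps (λ x∈ps → x∉ (there (there x∈ps)))) ⟩
    0 ∎
    where open ≡-Reasoning

  degreeIn-matchingOf-∈ : ∀ ps {x} → Unique (unpair ps) → x ∈ unpair ps → degreeIn (matchingOf ps) x ≡ 1
  degreeIn-matchingOf-∈ ((i , j) ∷ ps) {x} ((i≢j ∷ i∉) ∷ (j∉ ∷ u)) x∈ =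
    trans (degreeIn-++ (edgeBetween i j) (matchingOf ps) x) (split x∈)
    where
    split : x ∈ i ∷ j ∷ unpair ps → degreeIn (edgeBetween i j) x + degreeIn (matchingOf ps) x ≡ 1
    split (here refl) = cong₂ _+_ (degreeIn-edgeBetween-end {i} {j} i≢j (inj₁ refl))
                                  (degreeIn-matchingOf-∉ ps (All¬⇒¬Any i∉))
    split (there (here refl)) = cong₂ _+_ (degreeIn-edgeBetween-end {i} {j} i≢j (inj₂ refl))
                                          (degreeIn-matchingOf-∉ ps (All¬⇒¬Any j∉))
    split (there (there x∈ps)) =
      cong₂ _+_ (degreeIn-edgeBetween-other {i} {j} (λ { refl → All¬⇒¬Any i∉ x∈ps })
                                                    (λ { refl → All¬⇒¬Any j∉ x∈ps }))
                (degreeIn-matchingOf-∈ ps u x∈ps)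

  matchingOf-perfect : ∀ ps → Unique (unpair ps) → (∀ x → x ∈ unpair ps) → PerfectMatching (matchingOf ps)
  matchingOf-perfect ps u complete x = degreeIn-matchingOf-∈ ps u (complete x)

  sumBy-allEdges-double : (h : Edge m → ℕ) →
    sumBy h (allEdges m) + sumBy h (allEdges m) ≡
    sumBy (λ i → sumBy (λ j → sumBy h (edgeBetween i j)) (allFin m)) (allFin m)
  sumBy-allEdges-double h = begin
    sumBy h (allEdges m) + sumBy h (allEdges m)
      ≡⟨ cong₂ _+_ S≡ S≡ ⟩
    S + S
      ≡⟨ cong (S +_) (sumBy-swap (λ i j → sumBy h (orderedEdge i j)) (allFin m) (allFin m)) ⟩
    S + sumBy (λ i → sumBy (λ j → sumBy h (orderedEdge j i)) (allFin m)) (allFin m)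
      ≡⟨ sumBy-+ (λ i → sumBy (λ j → sumBy h (orderedEdge i j)) (allFin m)) _ (allFin m) ⟨
    sumBy (λ i → sumBy (λ j → sumBy h (orderedEdge i j)) (allFin m)
               + sumBy (λ j → sumBy h (orderedEdge j i)) (allFin m)) (allFin m)
      ≡⟨ sumBy-cong (λ i → trans (sumBy-cong (λ j → sumBy-++ h (orderedEdge i j) (orderedEdge j i)) (allFin m))
                                 (sumBy-+ (λ j → sumBy h (orderedEdge i j)) _ (allFin m)))
                    (allFin m) ⟨
    sumBy (λ i → sumBy (λ j → sumBy h (edgeBetween i j)) (allFin m)) (allFin m) ∎
    where
    open ≡-Reasoning
    S : ℕ
    S = sumBy (λ i → sumBy (λ j → sumBy h (orderedEdge i j)) (allFin m)) (allFin m)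
    S≡ : sumBy h (allEdges m) ≡ S
    S≡ = trans (cong (sumBy h) allEdges-≡)
           (trans (sumBy-concatMap h _ (allFin m))
             (sumBy-cong (λ i → sumBy-concatMap h (orderedEdge i) (allFin m)) (allFin m)))

  length-allFin : length (allFin m) ≡ m
  length-allFin = length-tabulate id

  sumBy-length-edgeBetween : ∀ i → sumBy (λ j → length (edgeBetween i j)) (allFin m) + 1 ≡ m
  sumBy-length-edgeBetween i with rest , allFin↭ ← ∈⇒↭∷ (∈-allFin i) = begin
    sumBy (λ j → length (edgeBetween i j)) (allFin m) + 1
      ≡⟨ cong (_+ 1) (sumBy-↭ (λ j → length (edgeBetween i j)) allFin↭) ⟩
    length (edgeBetween i i) + sumBy (λ j → length (edgeBetween i j)) rest + 1
      ≡⟨ cong₂ (λ a b → a + b + 1) (cong length (edgeBetween-self i))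
               (sumBy-≡1 _ (All.map length-edgeBetween-≢
                 (AllPairs.head (Unique-resp-↭ allFin↭ (UniqueP.allFin⁺ m))))) ⟩
    length rest + 1
      ≡⟨ +-comm (length rest) 1 ⟩
    length (i ∷ rest)
      ≡⟨ trans (sym (Perm.↭-length allFin↭)) length-allFin ⟩
    m ∎
    where open ≡-Reasoning

  length-allEdges : 2 * length (allEdges m) + m ≡ m * m
  length-allEdges = begin
    2 * length (allEdges m) + m
      ≡⟨ cong (λ x → length (allEdges m) + x + m) (+-identityʳ _) ⟩
    length (allEdges m) + length (allEdges m) + m
      ≡⟨ cong (λ x → x + x + m) (sumBy-1 (allEdges m)) ⟨
    sumBy (λ _ → 1) (allEdges m) + sumBy (λ _ → 1) (allEdges m) + m
      ≡⟨ cong (_+ m) (sumBy-allEdges-double (λ _ → 1)) ⟩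
    sumBy (λ i → sumBy (λ j → sumBy (λ _ → 1) (edgeBetween i j)) (allFin m)) (allFin m) + m
      ≡⟨ cong₂ _+_ (sumBy-cong (λ i → sumBy-cong (λ j → sumBy-1 (edgeBetween i j)) (allFin m)) (allFin m))
                   (trans (sym length-allFin) (sym (sumBy-1 (allFin m)))) ⟩
    sumBy (λ i → sumBy (λ j → length (edgeBetween i j)) (allFin m)) (allFin m) + sumBy (λ _ → 1) (allFin m)
      ≡⟨ sumBy-+ _ (λ _ → 1) (allFin m) ⟨
    sumBy (λ i → sumBy (λ j → length (edgeBetween i j)) (allFin m) + 1) (allFin m)
      ≡⟨ sumBy-cong sumBy-length-edgeBetween (allFin m) ⟩
    sumBy (λ _ → m) (allFin m)
      ≡⟨ trans (sumBy-const m (allFin m)) (cong (_* m) length-allFin) ⟩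
    m * m ∎
    where open ≡-Reasoning

  extend-to-ordering : ∀ {W : List (Fin m)} → Unique W → ∃[ R ] (W ++ R ↭ allFin m)
  extend-to-ordering {W} uW =
    R , ∼bag⇒↭ (unique∧set⇒bag uWR (UniqueP.allFin⁺ m) (mk⇔ (λ _ → ∈-allFin _) cover))
    where
    open import Data.List.Membership.DecPropositional Fin._≟_ using (_∈?_)
    R : List (Fin m)
    R = filter (λ z → ¬? (z ∈? W)) (allFin m)
    uWR : Unique (W ++ R)
    uWR = UniqueP.++⁺ uW (UniqueP.filter⁺ _ (UniqueP.allFin⁺ m))
            (λ (z∈W , z∈R) → proj₂ (∈-filter⁻ (λ z → ¬? (z ∈? W)) {xs = allFin m} z∈R) z∈W)
    cover : ∀ {z} → z ∈ allFin m → z ∈ W ++ R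
    cover {z} _ with z ∈? W
    ... | yes z∈W = ∈-++⁺ˡ z∈W
    ... | no z∉W = ∈-++⁺ʳ W (∈-filter⁺ (λ z → ¬? (z ∈? W)) (∈-allFin z) z∉W)

  ordering-perfect : ∀ {L} h → L ↭ allFin m → m ≡ h + h → PerfectMatching (matchingOf (pairUp L))
  ordering-perfect {L} h L↭ m≡h+h = matchingOf-perfect (pairUp L)
    (subst Unique (sym unpair≡) (Unique-resp-↭ (↭-sym L↭) (UniqueP.allFin⁺ m)))
    (λ x → subst (x ∈_) (sym unpair≡) (Perm.∈-resp-↭ (↭-sym L↭) (∈-allFin x)))
    where
    unpair≡ : unpair (pairUp L) ≡ L
    unpair≡ = unpair-pairUp h L (trans (Perm.↭-length L↭) (trans length-allFin m≡h+h))

  module Subgraph (h : Edge m → ℕ) (h≤1 : ∀ e → h e ≤ 1) where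

    adjacency : Fin m → Fin m → ℕ
    adjacency i j = sumBy h (edgeBetween i j)

    open SimpleGraph adjacency (sumBy-edgeBetween-sym h) (λ i → cong (sumBy h) (edgeBetween-self i))
      (sumBy-edgeBetween-≤1 h h≤1) public

    ordering-from-matching : ∀ {s} → Matching (allFin m) s → ∃[ L ] (L ↭ allFin m × s ≤ pairSum adjacency L)
    ordering-from-matching {s} M with R , W++R↭ ← extend-to-ordering (Matching.unique M) =
      unpair pairs ++ R , W++R↭ , (begin
        s                                           ≡⟨ size ⟨
        length pairs                                ≤⟨ length-≤-sumBy (λ (i , j) → adjacency i j) adjacent ⟩
        sumBy (λ (i , j) → adjacency i j) pairs     ≤⟨ m≤m+n _ _ ⟩
        sumBy (λ (i , j) → adjacency i j) pairs + pairSum adjacency R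
                                                    ≡⟨ sumBy-++ _ pairs (pairUp R) ⟨
        sumBy (λ (i , j) → adjacency i j) (pairs ++ pairUp R)
                                                    ≡⟨ cong (sumBy _) (pairUp-unpair-++ pairs R) ⟨
        pairSum adjacency (unpair pairs ++ R)       ∎)
      where
      open Matching M
      open ≤-Reasoning

    ordering-with-many-pairs : ∀ t e → m ≡ 3 * t + 2 + e →
      matchingThreshold t e < sumBy h (allEdges m) + sumBy h (allEdges m) →
      ∃[ L ] (L ↭ allFin m × suc t ≤ pairSum adjacency L)
    ordering-with-many-pairs t e m≡ large = ordering-from-matching
      (erdősGallai t e (allFin m) (UniqueP.allFin⁺ m) (trans length-allFin m≡)
        (subst (matchingThreshold t e <_) (sumBy-allEdges-double h) large))

-- Signed complete graphs

<-of-∣⊖∣< : ∀ p q B → ∣ p ⊖ q ∣ < B → p < q + B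
<-of-∣⊖∣< p q B ∣p⊖q∣<B with ≤-total p q
... | inj₁ p≤q = <-≤-trans (s≤s p≤q) (m<m+n q (<-≤-trans (s≤s z≤n) ∣p⊖q∣<B))
... | inj₂ q≤p = begin-strict
  p             ≡⟨ m+[n∸m]≡n q≤p ⟨
  q + (p ∸ q)   <⟨ +-monoʳ-< q (subst (_< B) (trans (∣m⊖n∣≡∣n⊖m∣ p q) (∣⊖∣-≤ q≤p)) ∣p⊖q∣<B) ⟩
  q + B         ∎
  where open ≤-Reasoning

∣⊖∣≤ : ∀ p q c → p ≤ q + c → q ≤ p + c → ∣ p ⊖ q ∣ ≤ c
∣⊖∣≤ p q c p≤q+c q≤p+c with ≤-total p q
... | inj₁ p≤q = subst (_≤ c) (sym (∣⊖∣-≤ p≤q)) (m≤n+o⇒m∸n≤o q p q≤p+c)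
... | inj₂ q≤p =
  subst (_≤ c) (sym (trans (∣m⊖n∣≡∣n⊖m∣ p q) (∣⊖∣-≤ q≤p))) (m≤n+o⇒m∸n≤o p q p≤q+c)

<-double-of-∣⊖∣< : ∀ p q β B → ∣ p ⊖ q ∣ < B → p + q ≡ β + B → β < q + q
<-double-of-∣⊖∣< p q β B ∣p⊖q∣<B p+q≡ = +-cancelʳ-< B β (q + q) (begin-strict
  β + B       ≡⟨ p+q≡ ⟨
  p + q       <⟨ +-monoˡ-< q (<-of-∣⊖∣< p q B ∣p⊖q∣<B) ⟩
  q + B + q   ≡⟨ +-+-swap q B q ⟩
  q + q + B   ∎)
  where
  open ≤-Reasoning
  +-+-swap : ∀ x y z → x + y + z ≡ x + z + y
  +-+-swap = solve-∀

∣⊖∣≤-window : ∀ p q lo c → p + q ≡ lo + (lo + c) → lo ≤ q → q ≤ lo + c → ∣ p ⊖ q ∣ ≤ c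
∣⊖∣≤-window p q lo c p+q≡ lo≤q q≤hi = ∣⊖∣≤ p q c
  (+-cancelʳ-≤ q p (q + c) (begin
    p + q            ≡⟨ p+q≡ ⟩
    lo + (lo + c)    ≤⟨ +-mono-≤ lo≤q (+-monoˡ-≤ c lo≤q) ⟩
    q + (q + c)      ≡⟨ +-comm q (q + c) ⟩
    q + c + q        ∎))
  (+-cancelʳ-≤ q q (p + c) (begin
    q + q                  ≤⟨ +-mono-≤ q≤hi q≤hi ⟩
    lo + c + (lo + c)      ≡⟨ +-rotate c lo (lo + c) ⟨
    c + (lo + (lo + c))    ≡⟨ cong (c +_) p+q≡ ⟨
    c + (p + q)            ≡⟨ +-rotate c p q ⟩
    p + c + q              ∎))
  where
  open ≤-Reasoning
  +-rotate : ∀ x y z → x + (y + z) ≡ y + x + z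
  +-rotate = solve-∀

isPositive isNegative : Sign → ℕ
isPositive plus = 1
isPositive minus = 0
isNegative plus = 0
isNegative minus = 1

isPositive+isNegative : ∀ s → isPositive s + isNegative s ≡ 1
isPositive+isNegative plus = refl
isPositive+isNegative minus = refl

isPositive≤1 : ∀ s → isPositive s ≤ 1
isPositive≤1 s = ≤-trans (m≤m+n _ (isNegative s)) (≤-reflexive (isPositive+isNegative s))

isNegative≤1 : ∀ s → isNegative s ≤ 1
isNegative≤1 s = ≤-trans (m≤n+m _ (isPositive s)) (≤-reflexive (isPositive+isNegative s))

module Signing {m : ℕ} (σ : Edge m → Sign) where

  positive negative : Edge m → ℕ
  positive = isPositive ∘ σ
  negative = isNegative ∘ σ

  module Pos = Subgraph positive (isPositive≤1 ∘ σ)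
  module Neg = Subgraph negative (isNegative≤1 ∘ σ)

  posPairs negPairs : List (Fin m) → ℕ
  posPairs = pairSum Pos.adjacency
  negPairs = pairSum Neg.adjacency

  σsum-⊖ : ∀ es → σsum σ es ≡ sumBy positive es ⊖ sumBy negative es
  σsum-⊖ [] = refl
  σsum-⊖ (e ∷ es) with σ e
  ... | plus = trans (cong (ℤ._+_ (signℤ plus)) (σsum-⊖ es))
                     (distribʳ-⊖-+-pos 1 (sumBy positive es) (sumBy negative es))
  ... | minus = trans (cong (ℤ._+_ (signℤ minus)) (σsum-⊖ es))
                      (distribʳ-⊖-+-neg 0 (sumBy positive es) (sumBy negative es))

  positive+negative : ∀ es → sumBy positive es + sumBy negative es ≡ length es
  positive+negative es =
    trans (sym (sumBy-+ positive negative es))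
          (sumBy-≡1 _ {es} (All.tabulate (λ {e} _ → isPositive+isNegative (σ e))))

  σsum-pairing : ∀ L → σsum σ (matchingOf (pairUp L)) ≡ posPairs L ⊖ negPairs L
  σsum-pairing L = trans (σsum-⊖ (matchingOf (pairUp L)))
    (cong₂ _⊖_ (sumBy-concatMap positive _ (pairUp L)) (sumBy-concatMap negative _ (pairUp L)))

  pairSum-positive+negative : ∀ {L} h → L ↭ allFin m → m ≡ h + h →
    posPairs L + negPairs L ≡ h
  pairSum-positive+negative {L} h L↭ m≡h+h = begin
    posPairs L + negPairs L
      ≡⟨ sumBy-+ (λ (i , j) → Pos.adjacency i j) (λ (i , j) → Neg.adjacency i j) (pairUp L) ⟨
    sumBy (λ (i , j) → Pos.adjacency i j + Neg.adjacency i j) (pairUp L)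
      ≡⟨ sumBy-≡1 _ (All.map (λ {(i , j)} i≢j → trans (positive+negative (edgeBetween i j))
                                                       (length-edgeBetween-≢ i≢j))
                             (Unique-unpair⇒≢ (pairUp L) (subst Unique (sym unpair≡) uL))) ⟩
    length (pairUp L)
      ≡⟨ length-pairUp h L |L| ⟩
    h ∎
    where
    open ≡-Reasoning
    |L| : length L ≡ h + h
    |L| = trans (Perm.↭-length L↭) (trans length-allFin m≡h+h)
    unpair≡ : unpair (pairUp L) ≡ L
    unpair≡ = unpair-pairUp h L |L|
    uL : Unique L
    uL = Unique-resp-↭ (↭-sym L↭) (UniqueP.allFin⁺ m)

  balanced-ordering : ∀ {L₁ L₂} lo hi h → m ≡ h + h → h ≡ lo + hi → lo < hi →
    L₁ ↭ allFin m → lo ≤ negPairs L₁ → L₂ ↭ allFin m → lo ≤ posPairs L₂ →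
    ∃[ L ] (L ↭ allFin m × lo ≤ negPairs L × negPairs L ≤ hi)
  balanced-ordering {L₁} {L₂} lo hi h m≡h+h h≡ lo<hi L₁↭ lo≤N₁ L₂↭ lo≤P₂ =
    back-to-orderings (intermediate-value negPairs 2 step lo hi (subst (_≤ suc hi) (+-comm 2 lo) (s≤s lo<hi))
                                          (↭⇒AdjacentSwaps (↭-trans L₁↭ (↭-sym L₂↭))) lo≤N₁ N₂≤hi)
    where
    step : ∀ {xs ys} → AdjacentSwap xs ys → negPairs xs ≤ negPairs ys + 2
    step = pairSum-swap Neg.adjacency (sumBy-edgeBetween-sym negative)
                                      (sumBy-edgeBetween-≤1 negative (isNegative≤1 ∘ σ))
    N₂≤hi : negPairs L₂ ≤ hi
    N₂≤hi = +-cancelˡ-≤ lo _ hi (≤-trans (+-monoˡ-≤ _ lo≤P₂)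
              (≤-reflexive (trans (pairSum-positive+negative h L₂↭ m≡h+h) h≡)))
    back-to-orderings : ∃[ L ] (AdjacentSwaps L₁ L × lo ≤ negPairs L × negPairs L ≤ hi) →
      ∃[ L ] (L ↭ allFin m × lo ≤ negPairs L × negPairs L ≤ hi)
    back-to-orderings (L , swaps , lo≤N , N≤hi) =
      L , ↭-trans (↭-sym (AdjacentSwaps⇒↭ swaps)) L₁↭ , lo≤N , N≤hi

  matching-with-small-sum : ∀ t e c h →
    m ≡ 3 * t + 2 + e → m ≡ h + h → h ≡ suc t + (suc t + c) → 1 ≤ c →
    matchingThreshold t e < sumBy negative (allEdges m) + sumBy negative (allEdges m) →
    matchingThreshold t e < sumBy positive (allEdges m) + sumBy positive (allEdges m) →
    Σ[ M ∈ List (Edge m) ] (PerfectMatching M × ∣ σsum σ M ∣ ≤ c)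
  matching-with-small-sum t e c h m≡ m≡h+h h≡ 1≤c negLarge posLarge
    with L₁ , L₁↭ , lo≤N₁ ← Neg.ordering-with-many-pairs t e m≡ negLarge
    with L₂ , L₂↭ , lo≤P₂ ← Pos.ordering-with-many-pairs t e m≡ posLarge
    with L , L↭ , lo≤N , N≤hi ← balanced-ordering (suc t) (suc t + c) h m≡h+h h≡ (m<m+n (suc t) 1≤c)
                                   L₁↭ lo≤N₁ L₂↭ lo≤P₂
    = matchingOf (pairUp L) , ordering-perfect h L↭ m≡h+h ,
      subst (λ s → ∣ s ∣ ≤ c) (sym (σsum-pairing L))
        (∣⊖∣≤-window _ _ (suc t) c (trans (pairSum-positive+negative h L↭ m≡h+h) h≡) lo≤N N≤hi)

matching-when-k≤n : ∀ a t (σ : Edge (4 * (suc (suc a) + t)) → Sign) →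
  let k = suc (suc a) ; n = k + t in
  ∣ σsum σ (allEdges (4 * n)) ∣ < n * (n ∸ 1) + k * (6 * n ∸ 1) + k ^ 2 →
  Σ[ M ∈ List (Edge (4 * n)) ] (PerfectMatching M × ∣ σsum σ M ∣ ≤ 2 * k ∸ 2)
matching-when-k≤n a t σ hyp =
  matching-with-small-sum t e (2 * k ∸ 2) (2 * n) (vertices a t) (halves n) pairs
    (subst (1 ≤_) (sym c≡) (s≤s z≤n))
    (<-double-of-∣⊖∣< P N β B ∣P⊖N∣<B P+N≡β+B)
    (<-double-of-∣⊖∣< N P β B (subst (_< B) (∣m⊖n∣≡∣n⊖m∣ P N) ∣P⊖N∣<B)
                              (trans (+-comm N P) P+N≡β+B))
  where
  open Signing σ
  k n m e β B P N : ℕ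
  k = suc (suc a)
  n = k + t
  m = 4 * n
  e = 6 + 4 * a + t
  β = matchingThreshold t e
  B = n * (n ∸ 1) + k * (6 * n ∸ 1) + k ^ 2
  P = sumBy positive (allEdges m)
  N = sumBy negative (allEdges m)
  c≡ : 2 * k ∸ 2 ≡ 2 + 2 * a
  c≡ = cong (_∸ 2) (identity a)
    where
    identity : ∀ a → 2 * (2 + a) ≡ 2 + (2 + 2 * a)
    identity = solve-∀
  vertices : ∀ a t → 4 * (2 + a + t) ≡ 3 * t + 2 + (6 + 4 * a + t)
  vertices = solve-∀
  halves : ∀ n → 4 * n ≡ 2 * n + 2 * n
  halves = solve-∀
  pairs : 2 * n ≡ suc t + (suc t + (2 * k ∸ 2))
  pairs = trans (identity a t) (cong (λ c → suc t + (suc t + c)) (sym c≡))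
    where
    identity : ∀ a t → 2 * (2 + a + t) ≡ suc t + (suc t + (2 + 2 * a))
    identity = solve-∀
  B≡ : B ≡ (2 + a + t) * (1 + a + t) + (2 + a) * (11 + 6 * a + 6 * t) + (2 + a) * ((2 + a) * 1)
  B≡ = cong (λ x → n * (n ∸ 1) + k * (x ∸ 1) + k ^ 2) (identity a t)
    where
    identity : ∀ a t → 6 * (2 + a + t) ≡ 1 + (11 + 6 * a + 6 * t)
    identity = solve-∀
  counting : ∀ a t →
    2 * (5 * t * t + 3 * t + 2 * t * (6 + 4 * a + t)
         + ((2 + a + t) * (1 + a + t) + (2 + a) * (11 + 6 * a + 6 * t) + (2 + a) * ((2 + a) * 1)))
      + 4 * (2 + a + t)
    ≡ 4 * (2 + a + t) * (4 * (2 + a + t))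
  counting = solve-∀
  -- B is exactly |E(K_4n)| − β, so the hypothesis puts both colour classes above β / 2 edges.
  P+N≡β+B : P + N ≡ β + B
  P+N≡β+B = *-cancelˡ-≡ _ _ 2 (+-cancelʳ-≡ m _ _ (begin
    2 * (P + N) + m                    ≡⟨ cong (λ x → 2 * x + m) (positive+negative (allEdges m)) ⟩
    2 * length (allEdges m) + m        ≡⟨ length-allEdges {m} ⟩
    m * m                              ≡⟨ counting a t ⟨
    2 * (β + _) + m                    ≡⟨ cong (λ x → 2 * (β + x) + m) B≡ ⟨
    2 * (β + B) + m                    ∎))
    where open ≡-Reasoning
  ∣P⊖N∣<B : ∣ P ⊖ N ∣ < B
  ∣P⊖N∣<B = subst (λ s → ∣ s ∣ < B) (σsum-⊖ (allEdges m)) hyp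

matching-when-n<k : ∀ n k → n < k → (σ : Edge (4 * n) → Sign) →
  Σ[ M ∈ List (Edge (4 * n)) ] (PerfectMatching M × ∣ σsum σ M ∣ ≤ 2 * k ∸ 2)
matching-when-n<k n k n<k σ =
  matchingOf (pairUp (allFin (4 * n))) , ordering-perfect (2 * n) ↭-refl (halves n) ,
  subst (λ s → ∣ s ∣ ≤ 2 * k ∸ 2) (sym (σsum-pairing (allFin (4 * n)))) (begin
    ∣ P ⊖ N ∣        ≤⟨ ∣m⊝n∣≤m⊔n P N ⟩
    P ⊔ N            ≤⟨ m⊔n≤m+n P N ⟩
    P + N            ≡⟨ pairSum-positive+negative (2 * n) ↭-refl (halves n) ⟩
    2 * n            ≡⟨ cong (_∸ 2) (identity n) ⟨
    2 * suc n ∸ 2    ≤⟨ ∸-monoˡ-≤ 2 (*-monoʳ-≤ 2 n<k) ⟩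
    2 * k ∸ 2        ∎)
  where
  open Signing σ
  open ≤-Reasoning
  P N : ℕ
  P = posPairs (allFin (4 * n))
  N = negPairs (allFin (4 * n))
  halves : ∀ n → 4 * n ≡ 2 * n + 2 * n
  halves = solve-∀
  identity : ∀ n → 2 * suc n ≡ 2 + 2 * n
  identity = solve-∀

theorem3 : (n k : ℕ) → 1 ≤ n → 2 ≤ k →
    (σ : Edge (4 * n) → Sign) →
    ∣ σsum σ (allEdges (4 * n)) ∣ < n * (n ∸ 1) + k * (6 * n ∸ 1) + k ^ 2 →
    Σ[ M ∈ List (Edge (4 * n)) ]
      (PerfectMatching M × ∣ σsum σ M ∣ ≤ 2 * k ∸ 2)
theorem3 n (suc (suc a)) _ (s≤s (s≤s z≤n)) σ hyp with suc (suc a) ≤? n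
... | no k≰n = matching-when-n<k n (suc (suc a)) (≰⇒> k≰n) σ
... | yes k≤n with t , refl ← m≤n⇒∃[o]m+o≡n k≤n = matching-when-k≤n a t σ hyp
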